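{- Let $G=(V,E)$ be a simple undirected graph with edge weights $\omega\colon E\to\mathbb N$, let $C\subseteq V$ be a vertex cover of $G$, and let $H$ be the hop graph for $G$ and $C$, with parts $X=(C)_2$ and $Y=V\setminus C$. Let $P$ be an optimal TSP tour of $G$ that, among all optimal TSP tours of $G$, minimizes the number of hops. Then each vertex of $X=(C)_2$ has degree at most one in the multigraph $H^P$.
   Context: For a set $V$, $(V)_2:=(V\times V)\setminus\{(v,v)\mid v\in V\}$ denotes the set of ordered pairs of distinct elements. $N(v)$ is the open neighborhood of $v$. A walk is a sequence $(v_0,\dots,v_\ell)$ of vertices with consecutive vertices adjacent (vertices may repeat); it is closed if $v_0=v_\ell$; its weight is the sum of $\omega$ over its consecutive pairs. A TSP tour of $G$ is a closed walk containing all vertices of $G$; it is optimal if it has minimum weight among all TSP tours. Given a vertex cover $C$, every vertex $s\in V\setminus C$ has all neighbors in $C$, so each occurrence of $s$ in a TSP tour is within a subwalk (consecutive vertices) $(u,s,v)$ with $u,v\in C$; it is called a hop if $u\neq v$, i.e. $(u,v)\in(C)_2$, and a loop if $u=v$. The hop graph $H$ for $G$ and $C$ is the edge-weighted bipartite graph with vertex set partitioned into $X:=(C)_2$ and $Y:=V\setminus C$, containing, for each $x=(u,v)\in X$ and each $y\in (N(u)\cap N(v))\setminus C$, an edge $\{x,y\}$ of cost $\omega^H(\{x,y\}):=\omega(\{u,y\})+\omega(\{y,v\})-2\omega_{\min}(y)$, where $\omega_{\min}(s):=\min_{w\in N(s)}\omega(\{s,w\})$. For a TSP tour $P$, $H^P$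 is the multigraph on the vertex set of $H$ containing each edge $\{x,y\}$ of $H$, with $x=(u,v)\in X$ and $y\in Y$, with multiplicity equal to the number of hops $(u,y,v)$ in $P$. -}

module Defs where

open import Data.Nat using (ℕ; _+_; _≤_)
open import Data.Fin using (Fin)
open import Data.Fin.Properties using (_≟_)
open import Data.Fin.Subset using (Subset; _∈_; _∉_)
open import Data.Fin.Subset.Properties using (_∈?_)
open import Data.List using (List; []; _∷_; length; filter; map; allFin; reverse)
open import Data.Nat.ListAction using (sum)
open import Data.List.Relation.Unary.Linked using (Linked)
import Data.List.Membership.Propositional as LM
open import Data.Maybe using (Maybe; just; nothing)
open import Data.Product using (_×_; _,_; Σ)
open import Data.Product.Properties using (≡-dec)
open import Data.Sum using (_⊎_)
open import Relation.Binary.PropositionalEquality using (_≡_; _≢_)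
open import Relation.Nullary using (Dec; yes; no; ¬_)
open import Relation.Nullary.Decidable using (_×-dec_; ¬?)

-- A finite simple undirected graph on vertex set Fin n with edge weights.
-- The weight ω : E → ℕ is given as a symmetric function on all pairs;
-- only its values on edges are ever used.
record WGraph (n : ℕ) : Set₁ where
  field
    Adj       : Fin n → Fin n → Set
    Adj-sym   : ∀ {u v} → Adj u v → Adj v u
    Adj-irr   : ∀ {u} → ¬ Adj u u
    ω         : Fin n → Fin n → ℕ
    ω-sym     : ∀ u v → ω u v ≡ ω v u
open WGraph public

module _ {n : ℕ} (G : WGraph n) where

  IsVertexCover : Subset n → Set
  IsVertexCover C = ∀ u v → Adj G u v → (u ∈ C) ⊎ (v ∈ C)

  IsWalk : List (Fin n) → Set
  IsWalk P = (P ≢ []) × Linked (Adj G) P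

  IsClosedWalk : List (Fin n) → Set
  IsClosedWalk P = IsWalk P × (Data.List.head P ≡ Data.List.last P)

  weight : List (Fin n) → ℕ
  weight (u ∷ v ∷ P) = ω G u v + weight (v ∷ P)
  weight _ = 0

  IsTSPTour : List (Fin n) → Set
  IsTSPTour P = IsClosedWalk P × (∀ v → v LM.∈ P)

  IsOptimalTSPTour : List (Fin n) → Set
  IsOptimalTSPTour P = IsTSPTour P × (∀ Q → IsTSPTour Q → weight P ≤ weight Q)

Triple : ℕ → Set
Triple n = Fin n × Fin n × Fin n

triples : ∀ {n} → List (Fin n) → List (Triple n)
triples (a ∷ b ∷ c ∷ r) = (a , b , c) ∷ triples (b ∷ c ∷ r)
triples _ = []

-- For a closed walk (v₀,…,v_ℓ) (v₀ = v_ℓ), the occurrences of vertices are at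
-- positions 0,…,ℓ-1 (position ℓ is the same occurrence as position 0), and the
-- occurrence at position i lies in the subwalk (v_{i-1}, v_i, v_{i+1}), indices
-- taken cyclically (so position 0 gives (v_{ℓ-1}, v₀, v₁)).  These ℓ triples
-- are exactly the consecutive triples of (v_{ℓ-1}, v₀, v₁, …, v_ℓ).
occurrenceTriples : ∀ {n} → List (Fin n) → List (Triple n)
occurrenceTriples P with reverse P
... | _ ∷ p ∷ _ = triples (p ∷ P)
... | _ = []

IsHop : ∀ {n} → Subset n → Triple n → Set
IsHop C (u , s , v) = (s ∉ C) × (u ≢ v)

isHop? : ∀ {n} (C : Subset n) (t : Triple n) → Dec (IsHop C t)
isHop? C (u , s , v) = ¬? (s ∈? C) ×-dec ¬? (u ≟ v)

numHops : ∀ {n} → Subset n → List (Fin n) → ℕ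
numHops C P = length (filter (isHop? C) (occurrenceTriples P))

InX : ∀ {n} → Subset n → Fin n × Fin n → Set
InX C (u , v) = (u ∈ C) × (v ∈ C) × (u ≢ v)

triple≟ : ∀ {n} (s t : Triple n) → Dec (s ≡ t)
triple≟ = ≡-dec _≟_ (≡-dec _≟_ _≟_)

-- multiplicity of the edge {x,y} of H (x = (u,v) ∈ X, y ∈ Y) in H^P:
-- the number of hops (u,y,v) in P
multHP : ∀ {n} → Subset n → List (Fin n) → Fin n × Fin n → Fin n → ℕ
multHP C P (u , v) y =
  length (filter (λ t → isHop? C t ×-dec triple≟ t (u , y , v)) (occurrenceTriples P))

degHP : ∀ {n} → Subset n → List (Fin n) → Fin n × Fin n → ℕ
degHP {n} C P x = sum (map (multHP C P x) (filter (λ y → ¬? (y ∈? C)) (allFin n)))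

module Submission where

-- Suppose two occurrences of vertices y, y′ ∉ C are hops (u, y, v) and (u, y′, v) of P for the
-- same pair (u, v).  Up to rotation, P is the closed walk y S y′ T y with S and T walks from v
-- to u.  Reversing S turns both hops into loops (u, y, u) and (v, y′, v); reversing T instead
-- gives (v, y, v) and (u, y′, u).  All other hops are unchanged, since S and T begin and end
-- in C.  By symmetry of ω the two rerouted tours together weigh exactly twice as much as P, so
-- one of them is again optimal, yet it has two hops fewer than P.  The degree of (u, v) in H^P
-- counts exactly these hops, hence is at most one.

open import Defs
open import Data.Nat using (ℕ; zero; suc; _+_; _≤_; _<_; z≤n; s≤s; _≤?_)
open import Data.Nat.Properties
  using (module ≤-Reasoning; ≤-trans; ≤-reflexive; <-irrefl; <-≤-trans; <⇒≱; suc-injective; n≤1+n; ≰⇒>;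
         +-assoc; +-comm; +-identityʳ; +-mono-≤; +-mono-<; +-monoʳ-≤)
open import Data.Nat.ListAction using (sum)
open import Data.Nat.Tactic.RingSolver using (solve-∀)
open import Data.Fin using (Fin)
open import Data.Fin.Properties using (_≟_)
open import Data.Fin.Subset using (Subset; _∈_; _∉_)
open import Data.Fin.Subset.Properties using (_∈?_)
open import Data.List using (List; []; _∷_; _++_; _∷ʳ_; [_]; length; filter; map; reverse; last)
open import Data.List.Properties
  using (length-++; filter-++; filter-accept; filter-reject; ++-assoc; ++-identityʳ; ∷ʳ-++;
         reverse-++; unfold-reverse; ∷-injective; ∷-injectiveˡ; ∷-injectiveʳ; map-cong)
open import Data.List.Relation.Unary.All as All using (All; []; _∷_)
open import Data.List.Relation.Unary.AllPairs using ([]; _∷_)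
open import Data.List.Relation.Unary.Unique.Propositional using (Unique)
open import Data.List.Relation.Unary.Unique.Propositional.Properties using (allFin⁺; filter⁺)
open import Data.List.Relation.Unary.Linked using (Linked; []; [-]; _∷_)
open import Data.List.Relation.Unary.Any using (here; there)
open import Data.List.Membership.Propositional.Properties using (∈-++⁺ˡ; ∈-++⁺ʳ; ∈-++⁻)
import Data.List.Membership.Propositional as List
open import Data.List.Relation.Binary.Permutation.Propositional
  using (_↭_; prep; ↭-sym; module PermutationReasoning)
open import Data.List.Relation.Binary.Permutation.Propositional.Properties
  using (++⁺ˡ; ++⁺ʳ; ↭-reverse; ∈-resp-↭)
open import Data.Maybe.Properties using (just-injective)
open import Data.Product using (_×_; _,_; proj₁; proj₂; ∃; ∃₂)
open import Data.Sum using (_⊎_; inj₁; inj₂; [_,_]′)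
open import Data.Empty using (⊥; ⊥-elim)
open import Function using (_∘_)
open import Relation.Binary using (Rel; Symmetric)
open import Relation.Binary.PropositionalEquality
  using (_≡_; _≢_; refl; sym; trans; cong; cong₂; subst; module ≡-Reasoning)
open import Relation.Nullary using (¬_; yes; no)
open import Relation.Nullary.Decidable using (_×-dec_; ¬?)
open import Relation.Unary using (Pred; Decidable)

module _ {a p} {A : Set a} {P : Pred A p} (P? : Decidable P) where

  count : List A → ℕ
  count xs = length (filter P? xs)

  count-++ : ∀ xs ys → count (xs ++ ys) ≡ count xs + count ys
  count-++ xs ys = trans (cong length (filter-++ P? xs ys)) (length-++ (filter P? xs))

  count-accept : ∀ {x} → P x → count [ x ] ≡ 1
  count-accept px = cong length (filter-accept P? px)

  count-reject : ∀ {x} → ¬ P x → count [ x ] ≡ 0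
  count-reject ¬px = cong length (filter-reject P? ¬px)

  count-∷ʳ : ∀ xs x → count (xs ∷ʳ x) ≡ count (x ∷ xs)
  count-∷ʳ xs x = begin
    count (xs ∷ʳ x)           ≡⟨ count-++ xs [ x ] ⟩
    count xs + count [ x ]    ≡⟨ +-comm (count xs) _ ⟩
    count [ x ] + count xs    ≡⟨ count-++ [ x ] xs ⟨
    count (x ∷ xs)            ∎
    where open ≡-Reasoning

  count-singleton-≡ : ∀ {x y} → (P x → P y) → (P y → P x) → count [ x ] ≡ count [ y ]
  count-singleton-≡ {x} {y} x⇒y y⇒x with P? x | P? y
  ... | yes _  | yes _  = refl
  ... | no _   | no _   = refl
  ... | yes px | no ¬py = ⊥-elim (¬py (x⇒y px))
  ... | no ¬px | yes py = ⊥-elim (¬px (y⇒x py))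

  count-split : ∀ xs {k} → count xs ≡ suc k →
                ∃₂ λ ys zs → ∃ λ t → xs ≡ ys ++ t ∷ zs × P t × count zs ≡ k
  count-split (x ∷ xs) eq with P? x
  ... | yes px = [] , xs , x , refl , px , suc-injective eq
  ... | no _ with count-split xs eq
  ...   | ys , zs , t , refl , pt , c = x ∷ ys , zs , t , refl , pt , c

  count≤1 : ∀ xs → (∀ {ys t zs t′ ws} → xs ≡ ys ++ t ∷ zs ++ t′ ∷ ws → P t → P t′ → ⊥) →
            count xs ≤ 1
  count≤1 xs no-two with count xs in eq
  ... | zero        = z≤n
  ... | suc zero    = s≤s z≤n
  ... | suc (suc k) with count-split xs eq
  ...   | ys , zs , t , refl , pt , c with count-split zs c
  ...     | _ , _ , t′ , refl , pt′ , _ = ⊥-elim (no-two refl pt pt′)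

module _ {a} {A : Set a} where

  sum-map-+ : ∀ (g h : A → ℕ) xs →
              sum (map (λ x → g x + h x) xs) ≡ sum (map g xs) + sum (map h xs)
  sum-map-+ g h [] = refl
  sum-map-+ g h (x ∷ xs) =
    trans (cong (g x + h x +_) (sum-map-+ g h xs)) (interchange (g x) (h x) (sum (map g xs)) (sum (map h xs)))
    where
    interchange : ∀ m n o p → (m + n) + (o + p) ≡ (m + o) + (n + p)
    interchange = solve-∀

  sum-map-zero : ∀ {g : A → ℕ} {xs} → All (λ x → g x ≡ 0) xs → sum (map g xs) ≡ 0
  sum-map-zero []           = refl
  sum-map-zero (gx≡0 ∷ gxs) = cong₂ _+_ gx≡0 (sum-map-zero gxs)

module _ {a b p q} {A : Set a} {B : Set b} {Q : Pred A q} (Q? : Decidable Q)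
         {P : B → Pred A p} (P? : ∀ y → Decidable (P y))
         (f : A → B) (fibre : ∀ {y t} → P y t → Q t × f t ≡ y) where

  sum-count-fibres-singleton≤1 : ∀ {ys} → Unique ys → ∀ t →
                                 sum (map (λ y → count (P? y) [ t ]) ys) ≤ 1
  sum-count-fibres-singleton≤1 []                  t = z≤n
  sum-count-fibres-singleton≤1 {y ∷ ys} (y∉ys ∷ u) t with P? y t
  ... | yes pyt = s≤s (≤-reflexive (sum-map-zero (All.map others y∉ys)))
    where
    others : ∀ {y′} → y ≢ y′ → count (P? y′) [ t ] ≡ 0
    others y≢y′ = count-reject (P? _)
      (λ py′t → y≢y′ (trans (sym (proj₂ (fibre pyt))) (proj₂ (fibre py′t))))
  ... | no _ = sum-count-fibres-singleton≤1 u t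

  sum-count-fibres≤count : ∀ {ys} → Unique ys → ∀ xs →
                           sum (map (λ y → count (P? y) xs) ys) ≤ count Q? xs
  sum-count-fibres≤count {ys} u [] = ≤-reflexive (sum-map-zero (All.universal (λ _ → refl) ys))
  sum-count-fibres≤count {ys} u (x ∷ xs) = begin
    sum (map (λ y → count (P? y) (x ∷ xs)) ys)
      ≡⟨ cong sum (map-cong (λ y → count-++ (P? y) [ x ] xs) ys) ⟩
    sum (map (λ y → count (P? y) [ x ] + count (P? y) xs) ys)
      ≡⟨ sum-map-+ (λ y → count (P? y) [ x ]) (λ y → count (P? y) xs) ys ⟩
    sum (map (λ y → count (P? y) [ x ]) ys) + sum (map (λ y → count (P? y) xs) ys)
      ≤⟨ +-mono-≤ singleton (sum-count-fibres≤count u xs) ⟩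
    count Q? [ x ] + count Q? xs
      ≡⟨ count-++ Q? [ x ] xs ⟨
    count Q? (x ∷ xs) ∎
    where
    open ≤-Reasoning
    singleton : sum (map (λ y → count (P? y) [ x ]) ys) ≤ count Q? [ x ]
    singleton with Q? x
    ... | yes qx = sum-count-fibres-singleton≤1 u x
    ... | no ¬qx =
      ≤-reflexive (sum-map-zero (All.universal (λ y → count-reject (P? y) (¬qx ∘ proj₁ ∘ fibre)) ys))

module _ {a} {A : Set a} where

  last-++ : ∀ xs {y : A} {ys} → last (xs ++ y ∷ ys) ≡ last (y ∷ ys)
  last-++ []           = refl
  last-++ (x ∷ [])     = refl
  last-++ (x ∷ x′ ∷ xs) = last-++ (x′ ∷ xs)

  ++-∷≢[] : ∀ (xs : List A) {x ys} → xs ++ x ∷ ys ≢ []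
  ++-∷≢[] []      ()
  ++-∷≢[] (_ ∷ _) ()

  block-before-suffix : ∀ xs ys {c d e f g : A} {zs} → xs ++ c ∷ d ∷ [] ≡ ys ++ e ∷ f ∷ g ∷ zs →
                        g ≢ c → g ≢ d → ∃ λ N → xs ≡ ys ++ e ∷ f ∷ g ∷ N
  block-before-suffix []                 []                ()
  block-before-suffix []                 (_ ∷ [])          ()
  block-before-suffix []                 (_ ∷ _ ∷ [])      ()
  block-before-suffix []                 (_ ∷ _ ∷ _ ∷ _)   ()
  block-before-suffix (_ ∷ [])           []           refl _   g≢d = ⊥-elim (g≢d refl)
  block-before-suffix (_ ∷ _ ∷ [])       []           refl g≢c _   = ⊥-elim (g≢c refl)
  block-before-suffix (_ ∷ _ ∷ _ ∷ xs)   []           refl _   _   = xs , refl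
  block-before-suffix (x ∷ xs)           (_ ∷ ys)     eq   g≢c g≢d with ∷-injective eq
  ... | refl , eq′ with block-before-suffix xs ys eq′ g≢c g≢d
  ...   | N , eq″ = N , cong (x ∷_) eq″

  ∷ʳ-view : ∀ (x : A) xs → ∃₂ λ ys z → x ∷ xs ≡ ys ∷ʳ z
  ∷ʳ-view x []       = [] , x , refl
  ∷ʳ-view x (x′ ∷ xs) with ∷ʳ-view x′ xs
  ... | ys , z , eq = x ∷ ys , z , cong (x ∷_) eq

  module _ {ℓ} {R : Rel A ℓ} where

    linked-++⁻ : ∀ xs {x ys} → Linked R (xs ++ x ∷ ys) → Linked R (xs ∷ʳ x) × Linked R (x ∷ ys)
    linked-++⁻ []            l       = [-] , l
    linked-++⁻ (_ ∷ [])      (r ∷ l) = r ∷ [-] , l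
    linked-++⁻ (_ ∷ x′ ∷ xs) (r ∷ l) with linked-++⁻ (x′ ∷ xs) l
    ... | l₁ , l₂ = r ∷ l₁ , l₂

    linked-++⁺ : ∀ xs {x ys} → Linked R (xs ∷ʳ x) → Linked R (x ∷ ys) → Linked R (xs ++ x ∷ ys)
    linked-++⁺ []            _          l₂ = l₂
    linked-++⁺ (_ ∷ [])      (r ∷ [-])  l₂ = r ∷ l₂
    linked-++⁺ (_ ∷ x′ ∷ xs) (r ∷ l₁)   l₂ = r ∷ linked-++⁺ (x′ ∷ xs) l₁ l₂

    linked-reverse : Symmetric R → ∀ {xs} → Linked R xs → Linked R (reverse xs)
    linked-reverse R-sym {[]}         l        = l
    linked-reverse R-sym {_ ∷ []}     l        = l
    linked-reverse R-sym {x ∷ y ∷ xs} (r ∷ l) =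
      subst (Linked R) (sym (reverse-++ (x ∷ y ∷ []) xs))
        (linked-++⁺ (reverse xs) (subst (Linked R) (unfold-reverse y xs) (linked-reverse R-sym l))
                                 (R-sym r ∷ [-]))

module _ {n : ℕ} where

  triples-++ : ∀ (xs : List (Fin n)) {x y ys} →
               triples (xs ++ x ∷ y ∷ ys) ≡ triples (xs ++ x ∷ y ∷ []) ++ triples (x ∷ y ∷ ys)
  triples-++ []                  = refl
  triples-++ (_ ∷ [])            = refl
  triples-++ (_ ∷ _ ∷ [])        = refl
  triples-++ (x ∷ x′ ∷ x″ ∷ xs) = cong ((x , x′ , x″) ∷_) (triples-++ (x′ ∷ x″ ∷ xs))

  triples≡++⇒ : ∀ (xs : List (Fin n)) ts {x y z us} → triples xs ≡ ts ++ (x , y , z) ∷ us →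
                ∃₂ λ pre post → xs ≡ pre ++ x ∷ y ∷ z ∷ post
  triples≡++⇒ []          ts eq = ⊥-elim (++-∷≢[] ts (sym eq))
  triples≡++⇒ (_ ∷ [])     ts eq = ⊥-elim (++-∷≢[] ts (sym eq))
  triples≡++⇒ (_ ∷ _ ∷ []) ts eq = ⊥-elim (++-∷≢[] ts (sym eq))
  triples≡++⇒ (_ ∷ _ ∷ _ ∷ xs) [] eq with ∷-injectiveˡ eq
  ... | refl = [] , xs , refl
  triples≡++⇒ (x ∷ x′ ∷ x″ ∷ xs) (_ ∷ ts) eq
    with triples≡++⇒ (x′ ∷ x″ ∷ xs) ts (∷-injectiveʳ eq)
  ... | pre , post , eq′ = x ∷ pre , post , cong (x ∷_) eq′

  occurrenceTriples-reverse : ∀ (xs : List (Fin n)) {x y ys} →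
                              reverse xs ≡ x ∷ y ∷ ys → occurrenceTriples xs ≡ triples (y ∷ xs)
  occurrenceTriples-reverse xs eq with reverse xs | eq
  ... | _ | refl = refl

  module _ {p} {P : Pred (Triple n) p} (P? : Decidable P) where

    private
      count-∷-+ : ∀ t {ts ts′ m} → count P? ts ≡ count P? ts′ + m →
                  count P? (t ∷ ts) ≡ count P? (t ∷ ts′) + m
      count-∷-+ t {ts} {ts′} {m} eq = begin
        count P? (t ∷ ts)                  ≡⟨ count-++ P? [ t ] ts ⟩
        count P? [ t ] + count P? ts       ≡⟨ cong (count P? [ t ] +_) eq ⟩
        count P? [ t ] + (count P? ts′ + m) ≡⟨ +-assoc (count P? [ t ]) _ _ ⟨
        count P? [ t ] + count P? ts′ + m   ≡⟨ cong (_+ m) (count-++ P? [ t ] ts′) ⟨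
        count P? (t ∷ ts′) + m              ∎
        where open ≡-Reasoning

    count-triples-++ : ∀ xs {x ys} → (∀ {w y} → ¬ P (w , x , y)) →
      count P? (triples (xs ++ x ∷ ys)) ≡ count P? (triples (xs ∷ʳ x)) + count P? (triples (x ∷ ys))
    count-triples-++ []                    ¬P = refl
    count-triples-++ (w ∷ []) {ys = []}     ¬P = refl
    count-triples-++ (w ∷ []) {x} {y ∷ ys} ¬P =
      trans (count-++ P? [ (w , x , y) ] _) (cong (_+ _) (count-reject P? ¬P))
    count-triples-++ (w ∷ w′ ∷ []) {x} {ys} ¬P = count-∷-+ _ (count-triples-++ (w′ ∷ []) {x} {ys} ¬P)
    count-triples-++ (w ∷ w′ ∷ w″ ∷ xs) ¬P = count-∷-+ _ (count-triples-++ (w′ ∷ w″ ∷ xs) ¬P)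

    count-triples-reverse : (∀ {x y z} → P (x , y , z) → P (z , y , x)) →
                            ∀ xs → count P? (triples (reverse xs)) ≡ count P? (triples xs)
    count-triples-reverse P-flip []          = refl
    count-triples-reverse P-flip (_ ∷ [])     = refl
    count-triples-reverse P-flip (_ ∷ _ ∷ []) = refl
    count-triples-reverse P-flip (x ∷ y ∷ z ∷ xs) = begin
      count P? (triples (reverse (x ∷ y ∷ z ∷ xs)))
        ≡⟨ cong (count P? ∘ triples) (reverse-++ (x ∷ y ∷ z ∷ []) xs) ⟩
      count P? (triples (reverse xs ++ z ∷ y ∷ x ∷ []))
        ≡⟨ cong (count P?) (triples-++ (reverse xs)) ⟩
      count P? (triples (reverse xs ++ z ∷ y ∷ []) ++ [ (z , y , x) ])
        ≡⟨ count-++ P? (triples (reverse xs ++ z ∷ y ∷ [])) _ ⟩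
      count P? (triples (reverse xs ++ z ∷ y ∷ [])) + count P? [ (z , y , x) ]
        ≡⟨ cong₂ _+_ (cong (count P? ∘ triples) (sym (reverse-++ (y ∷ z ∷ []) xs)))
                     (count-singleton-≡ P? P-flip P-flip) ⟩
      count P? (triples (reverse (y ∷ z ∷ xs))) + count P? [ (x , y , z) ]
        ≡⟨ cong (_+ count P? [ (x , y , z) ]) (count-triples-reverse P-flip (y ∷ z ∷ xs)) ⟩
      count P? (triples (y ∷ z ∷ xs)) + count P? [ (x , y , z) ]
        ≡⟨ +-comm (count P? (triples (y ∷ z ∷ xs))) _ ⟩
      count P? [ (x , y , z) ] + count P? (triples (y ∷ z ∷ xs))
        ≡⟨ count-++ P? [ (x , y , z) ] _ ⟨
      count P? (triples (x ∷ y ∷ z ∷ xs)) ∎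
      where
      open ≡-Reasoning

Segment : ∀ {a} → Set a → Set a
Segment A = A × List A × A

module _ {a} {A : Set a} where

  through : Segment A → List A → List A
  through (p , M , q) xs = p ∷ M ++ q ∷ xs

  path : Segment A → List A
  path S = through S []

  reverseSegment : Segment A → Segment A
  reverseSegment (p , M , q) = q , reverse M , p

  tour : A → Segment A → A → Segment A → List A
  tour x S y T = x ∷ through S (y ∷ through T (x ∷ []))

  through-++ : ∀ S xs → through S xs ≡ path S ++ xs
  through-++ (p , M , q) xs = cong (p ∷_) (sym (∷ʳ-++ M q xs))

  path-reverseSegment : ∀ S → path (reverseSegment S) ≡ reverse (path S)
  path-reverseSegment (p , M , q) =
    sym (trans (reverse-++ (p ∷ M) [ q ]) (cong (q ∷_) (unfold-reverse p M)))

  through-reverseSegment-↭ : ∀ S xs → through (reverseSegment S) xs ↭ through S xs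
  through-reverseSegment-↭ S xs = begin
    through (reverseSegment S) xs ≡⟨ through-++ (reverseSegment S) xs ⟩
    path (reverseSegment S) ++ xs ≡⟨ cong (_++ xs) (path-reverseSegment S) ⟩
    reverse (path S) ++ xs        ↭⟨ ++⁺ʳ xs (↭-reverse (path S)) ⟩
    path S ++ xs                  ≡⟨ through-++ S xs ⟨
    through S xs                  ∎
    where open PermutationReasoning

  through-↭ : ∀ S {xs ys} → xs ↭ ys → through S xs ↭ through S ys
  through-↭ (p , M , q) xs↭ys = prep p (++⁺ˡ M (prep q xs↭ys))

  module _ {ℓ} {R : Rel A ℓ} where

    linked-through⁻ : ∀ {p M q x y ys} → Linked R (x ∷ through (p , M , q) (y ∷ ys)) →
                      R x p × Linked R (path (p , M , q)) × R q y × Linked R (y ∷ ys)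
    linked-through⁻ {p} {M} (r ∷ l) with linked-++⁻ (p ∷ M) l
    ... | lS , r′ ∷ l′ = r , lS , r′ , l′

    linked-through⁺ : ∀ {p M q x y ys} →
                      R x p → Linked R (path (p , M , q)) → R q y → Linked R (y ∷ ys) →
                      Linked R (x ∷ through (p , M , q) (y ∷ ys))
    linked-through⁺ {p} {M} r lS r′ l′ = r ∷ linked-++⁺ (p ∷ M) lS (r′ ∷ l′)

    linked-tour⁻ : ∀ {x p M q y p′ N q′} → Linked R (tour x (p , M , q) y (p′ , N , q′)) →
                   (R x p × Linked R (path (p , M , q)) × R q y) ×
                   (R y p′ × Linked R (path (p′ , N , q′)) × R q′ x)
    linked-tour⁻ l with linked-through⁻ l
    ... | xp , lS , qy , l′ with linked-through⁻ l′
    ...   | yp′ , lT , q′x , _ = (xp , lS , qy) , (yp′ , lT , q′x)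

    linked-tour⁺ : ∀ {x p M q y p′ N q′} →
                   (R x p × Linked R (path (p , M , q)) × R q y) →
                   (R y p′ × Linked R (path (p′ , N , q′)) × R q′ x) →
                   Linked R (tour x (p , M , q) y (p′ , N , q′))
    linked-tour⁺ (xp , lS , qy) (yp′ , lT , q′x) =
      linked-through⁺ xp lS qy (linked-through⁺ yp′ lT q′x [-])

    linked-path-reverseSegment : Symmetric R → ∀ S → Linked R (path S) → Linked R (path (reverseSegment S))
    linked-path-reverseSegment R-sym S l =
      subst (Linked R) (sym (path-reverseSegment S)) (linked-reverse R-sym l)

-- (x , ys , z) encodes the closed walk x ys z x; keeping the vertex z visited just before the
-- return to x explicit is what makes its occurrence triples computable.
Cycle : ∀ {a} → Set a → Set a
Cycle A = A × List A × A

module _ {a} {A : Set a} where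

  walk : Cycle A → List A
  walk (x , ys , z) = x ∷ ys ++ z ∷ x ∷ []

  rotate : Cycle A → Cycle A
  rotate (x , []     , z) = z , [] , x
  rotate (x , y ∷ ys , z) = y , ys ∷ʳ z , x

  walk-rotate : ∀ x ys z → ∃₂ λ y ys′ → walk (x , ys , z) ≡ x ∷ y ∷ ys′ ∷ʳ x ×
                                       walk (rotate (x , ys , z)) ≡ y ∷ ys′ ++ x ∷ y ∷ []
  walk-rotate x []       z = z , [] , refl , refl
  walk-rotate x (y ∷ ys) z = y , ys ∷ʳ z , cong (λ l → x ∷ y ∷ l) (sym (∷ʳ-++ ys z [ x ])) , refl

  tour-walk : ∀ x {p M q} y {p′ N q′} →
              tour x (p , M , q) y (p′ , N , q′) ≡ walk (x , through (p , M , q) (y ∷ p′ ∷ N) , q′)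
  tour-walk x {p} {M} {q} y {p′} {N} {q′} =
    cong (λ l → x ∷ p ∷ l) (sym (++-assoc M (q ∷ y ∷ p′ ∷ N) (q′ ∷ x ∷ [])))

  linked-rotate : ∀ {ℓ} {R : Rel A ℓ} {x y ys} →
                  Linked R (x ∷ y ∷ ys ∷ʳ x) → Linked R (y ∷ ys ++ x ∷ y ∷ [])
  linked-rotate {ys = ys} (r ∷ l) = linked-++⁺ (_ ∷ ys) l (r ∷ [-])

  ∈-rotate : ∀ {v x y : A} {ys} → v List.∈ x ∷ y ∷ ys ∷ʳ x → v List.∈ y ∷ ys ++ x ∷ y ∷ []
  ∈-rotate {ys = ys} (here refl) = ∈-++⁺ʳ (_ ∷ ys) (here refl)
  ∈-rotate {ys = ys} (there v∈) with ∈-++⁻ (_ ∷ ys) v∈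
  ... | inj₁ v∈ys       = ∈-++⁺ˡ v∈ys
  ... | inj₂ (here v≡x) = ∈-++⁺ʳ (_ ∷ ys) (here v≡x)

module _ {n : ℕ} (G : WGraph n) where

  weight-++ : ∀ xs {x ys} → weight G (xs ++ x ∷ ys) ≡ weight G (xs ∷ʳ x) + weight G (x ∷ ys)
  weight-++ []             = refl
  weight-++ (x ∷ []) {y} {ys} = cong (_+ weight G (y ∷ ys)) (sym (+-identityʳ (ω G x y)))
  weight-++ (x ∷ x′ ∷ xs) {y} {ys} = trans (cong (ω G x x′ +_) (weight-++ (x′ ∷ xs)))
                                           (sym (+-assoc (ω G x x′) _ (weight G (y ∷ ys))))

  weight-reverse : ∀ xs → weight G (reverse xs) ≡ weight G xs
  weight-reverse []           = refl
  weight-reverse (_ ∷ [])     = refl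
  weight-reverse (x ∷ y ∷ xs) = begin
    weight G (reverse (x ∷ y ∷ xs))
      ≡⟨ cong (weight G) (reverse-++ (x ∷ y ∷ []) xs) ⟩
    weight G (reverse xs ++ y ∷ x ∷ [])
      ≡⟨ weight-++ (reverse xs) ⟩
    weight G (reverse xs ∷ʳ y) + (ω G y x + 0)
      ≡⟨ cong₂ _+_ (cong (weight G) (sym (unfold-reverse y xs))) (+-identityʳ _) ⟩
    weight G (reverse (y ∷ xs)) + ω G y x
      ≡⟨ cong₂ _+_ (weight-reverse (y ∷ xs)) (ω-sym G y x) ⟩
    weight G (y ∷ xs) + ω G x y
      ≡⟨ +-comm (weight G (y ∷ xs)) _ ⟩
    weight G (x ∷ y ∷ xs) ∎
    where open ≡-Reasoning

  weight-through : ∀ {p M q} x {y ys} → weight G (x ∷ through (p , M , q) (y ∷ ys)) ≡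
                   ω G x p + (weight G (path (p , M , q)) + (ω G q y + weight G (y ∷ ys)))
  weight-through {p} {M} x = cong (ω G x p +_) (weight-++ (p ∷ M))

  weight-tour : ∀ x {p M q} y {p′ N q′} → weight G (tour x (p , M , q) y (p′ , N , q′)) ≡
                ω G x p + weight G (path (p , M , q)) + ω G q y +
                (ω G y p′ + weight G (path (p′ , N , q′)) + ω G q′ x)
  weight-tour x {p} {M} {q} y {p′} {N} {q′} = begin
    weight G (tour x S y T)
      ≡⟨ weight-through {p} {M} {q} x ⟩
    ω G x p + (weight G (path S) + (ω G q y + weight G (y ∷ through T (x ∷ []))))
      ≡⟨ cong (λ w → ω G x p + (weight G (path S) + (ω G q y + w))) (weight-through {p′} {N} {q′} y) ⟩
    ω G x p + (weight G (path S) + (ω G q y + (ω G y p′ + (weight G (path T) + (ω G q′ x + 0)))))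
      ≡⟨ reassociate (ω G x p) _ _ (ω G y p′) (weight G (path T)) (ω G q′ x) ⟩
    ω G x p + weight G (path S) + ω G q y + (ω G y p′ + weight G (path T) + ω G q′ x) ∎
    where
    open ≡-Reasoning
    S = (p , M , q)
    T = (p′ , N , q′)
    reassociate : ∀ a b c d e f → a + (b + (c + (d + (e + (f + 0))))) ≡ a + b + c + (d + e + f)
    reassociate = solve-∀

  weight-path-reverseSegment : ∀ {p M q} → weight G (path (q , reverse M , p)) ≡ weight G (path (p , M , q))
  weight-path-reverseSegment {p} {M} {q} =
    trans (cong (weight G) (path-reverseSegment (p , M , q))) (weight-reverse (path (p , M , q)))

  weight-reverseSegments : ∀ x {p M q} y {N} →
    weight G (tour x (reverseSegment (p , M , q)) y (p , N , q)) +
    weight G (tour x (p , M , q) y (reverseSegment (p , N , q))) ≡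
    weight G (tour x (p , M , q) y (p , N , q)) + weight G (tour x (p , M , q) y (p , N , q))
  weight-reverseSegments x {p} {M} {q} y {N}
    rewrite weight-tour x {q} {reverse M} {p} y {p} {N} {q}
          | weight-tour x {p} {M} {q} y {q} {reverse N} {p}
          | weight-tour x {p} {M} {q} y {p} {N} {q}
          | weight-path-reverseSegment {p} {M} {q}
          | weight-path-reverseSegment {p} {N} {q}
          | ω-sym G x q | ω-sym G p y | ω-sym G y q | ω-sym G p x
    = exchange (ω G x p) (ω G q y) (ω G y p) (ω G q x) (weight G (path (p , M , q))) (weight G (path (p , N , q)))
    where
    exchange : ∀ α β γ δ s t →
      (δ + s + γ + (γ + t + δ)) + (α + s + β + (β + t + α)) ≡
      (α + s + β + (γ + t + δ)) + (α + s + β + (γ + t + δ))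
    exchange = solve-∀

  weight-rotate : ∀ c → weight G (walk (rotate c)) ≡ weight G (walk c)
  weight-rotate c@(x , ys , z) with walk-rotate x ys z
  ... | y , ys′ , eq , eq′ = begin
    weight G (walk (rotate c))                   ≡⟨ cong (weight G) eq′ ⟩
    weight G (y ∷ ys′ ++ x ∷ y ∷ [])             ≡⟨ weight-++ (y ∷ ys′) ⟩
    weight G (y ∷ ys′ ∷ʳ x) + (ω G x y + 0)      ≡⟨ cong (weight G (y ∷ ys′ ∷ʳ x) +_) (+-identityʳ _) ⟩
    weight G (y ∷ ys′ ∷ʳ x) + ω G x y            ≡⟨ +-comm (weight G (y ∷ ys′ ∷ʳ x)) _ ⟩
    weight G (x ∷ y ∷ ys′ ∷ʳ x)                  ≡⟨ cong (weight G) eq ⟨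
    weight G (walk c)                            ∎
    where open ≡-Reasoning

  walk-isTSPTour : ∀ c → Linked (Adj G) (walk c) → (∀ v → v List.∈ walk c) → IsTSPTour G (walk c)
  walk-isTSPTour (x , ys , z) l v∈ = (((λ ()) , l) , sym (last-++ (x ∷ ys))) , v∈

  rotate-isTSPTour : ∀ c → IsTSPTour G (walk c) → IsTSPTour G (walk (rotate c))
  rotate-isTSPTour c@(x , ys , z) (((_ , l) , _) , v∈) with walk-rotate x ys z
  ... | _ , _ , eq , eq′ = walk-isTSPTour (rotate c)
    (subst (Linked (Adj G)) (sym eq′) (linked-rotate (subst (Linked (Adj G)) eq l)))
    (λ v → subst (v List.∈_) (sym eq′) (∈-rotate (subst (v List.∈_) eq (v∈ v))))

  tour-isTSPTour : ∀ x {p M q} y {p′ N q′} → let P = tour x (p , M , q) y (p′ , N , q′) in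
                   Linked (Adj G) P → (∀ v → v List.∈ P) → IsTSPTour G P
  tour-isTSPTour x {p} {M} y {p′} {N} l v∈ =
    (((λ ()) , l) , sym (trans (last-++ (x ∷ p ∷ M)) (last-++ (p′ ∷ N)))) , v∈

  tour-reverseˡ : ∀ x {p M q} y {N} → IsTSPTour G (tour x (p , M , q) y (p , N , q)) →
                  IsTSPTour G (tour x (reverseSegment (p , M , q)) y (p , N , q))
  tour-reverseˡ x {p} {M} {q} y (((_ , l) , _) , v∈) with linked-tour⁻ l
  ... | (xp , lS , qy) , (yp , lT , qx) = tour-isTSPTour x y
    (linked-tour⁺ (Adj-sym G qx , linked-path-reverseSegment (Adj-sym G) (p , M , q) lS , Adj-sym G yp)
                  (yp , lT , qx))
    (λ v → ∈-resp-↭ (↭-sym (prep x (through-reverseSegment-↭ (p , M , q) _))) (v∈ v))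

  tour-reverseʳ : ∀ x {p M q} y {N} → IsTSPTour G (tour x (p , M , q) y (p , N , q)) →
                  IsTSPTour G (tour x (p , M , q) y (reverseSegment (p , N , q)))
  tour-reverseʳ x {p} {M} {q} y {N} (((_ , l) , _) , v∈) with linked-tour⁻ l
  ... | (xp , lS , qy) , (yp , lT , qx) = tour-isTSPTour x y
    (linked-tour⁺ (xp , lS , qy)
                  (Adj-sym G qy , linked-path-reverseSegment (Adj-sym G) (p , N , q) lT , Adj-sym G xp))
    (λ v → ∈-resp-↭ (↭-sym (prep x (through-↭ (p , M , q) (prep y (through-reverseSegment-↭ (p , N , q) _)))))
                    (v∈ v))

  walk-view : ∀ P → IsClosedWalk G P → occurrenceTriples P ≡ [] ⊎ ∃ λ c → P ≡ walk c
  walk-view []           _ = inj₁ refl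
  walk-view (x ∷ [])     _ = inj₁ refl
  walk-view (x ∷ y ∷ ys) ((_ , xy ∷ _) , closed) with ∷ʳ-view y ys
  ... | zs , z , eq with just-injective (trans closed (trans (cong (last ∘ (x ∷_)) eq) (last-++ (x ∷ zs))))
  ...   | refl with zs | eq
  ...     | []     | eq′ = ⊥-elim (Adj-irr G (subst (Adj G x) (∷-injectiveˡ eq′) xy))
  ...     | w ∷ ws | eq′ with ∷ʳ-view w ws
  ...       | vs , u , eq″ = inj₂ ((x , vs , u) ,
              cong (x ∷_) (trans eq′ (trans (cong (_∷ʳ x) eq″) (∷ʳ-++ vs u [ x ]))))

module _ {n : ℕ} where

  occurrenceTriples-walk : ∀ (x : Fin n) ys z →
                           occurrenceTriples (walk (x , ys , z)) ≡ triples (z ∷ walk (x , ys , z))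
  occurrenceTriples-walk x ys z =
    occurrenceTriples-reverse (walk (x , ys , z)) (reverse-++ (x ∷ ys) (z ∷ x ∷ []))

  occurrenceTriples-rotate : ∀ (c : Cycle (Fin n)) {t ts} → occurrenceTriples (walk c) ≡ t ∷ ts →
                             occurrenceTriples (walk (rotate c)) ≡ ts ∷ʳ t
  occurrenceTriples-rotate (x , []     , z) refl = refl
  occurrenceTriples-rotate (x , y ∷ ys , z) eq with trans (sym (occurrenceTriples-walk x (y ∷ ys) z)) eq
  ... | refl = begin
    occurrenceTriples (walk (y , ys ∷ʳ z , x))  ≡⟨ occurrenceTriples-walk y (ys ∷ʳ z) x ⟩
    triples (x ∷ y ∷ (ys ∷ʳ z) ++ x ∷ y ∷ [])   ≡⟨ cong (triples ∘ (x ∷_) ∘ (y ∷_)) (∷ʳ-++ ys z (x ∷ y ∷ [])) ⟩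
    triples ((x ∷ y ∷ ys) ++ z ∷ x ∷ y ∷ [])    ≡⟨ triples-++ (x ∷ y ∷ ys) ⟩
    triples (x ∷ y ∷ ys ++ z ∷ x ∷ []) ∷ʳ (z , x , y) ∎
    where open ≡-Reasoning

  walk-with-two-hops : ∀ (c : Cycle (Fin n)) {x y u v ts us} → u ≢ v → x ≢ u → x ≢ v →
                       occurrenceTriples (walk c) ≡ (u , x , v) ∷ ts ++ (u , y , v) ∷ us →
                       ∃₂ λ M N → walk c ≡ tour x (v , M , u) y (v , N , u)
  walk-with-two-hops (_ , [] , _) u≢v _ _ eq with ∷-injectiveˡ eq
  ... | refl = ⊥-elim (u≢v refl)
  walk-with-two-hops (x , w ∷ ws , z) {y = y} u≢v x≢u x≢v eq
    with ∷-injective (trans (sym (occurrenceTriples-walk x (w ∷ ws) z)) eq)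
  ... | refl , eq′ with triples≡++⇒ (x ∷ w ∷ ws ++ z ∷ x ∷ []) _ eq′
  ...   | []         , _ , e = ⊥-elim (x≢u (∷-injectiveˡ e))
  ...   | _ ∷ []     , _ , e = ⊥-elim (u≢v (sym (∷-injectiveˡ (∷-injectiveʳ e))))
  ...   | _ ∷ _ ∷ M , _ , e
    with block-before-suffix ws M (∷-injectiveʳ (∷-injectiveʳ e)) (u≢v ∘ sym) (x≢v ∘ sym)
  ...     | N , refl = M , N , sym (tour-walk x y)

module _ {n : ℕ} (C : Subset n) where

  hopIndicator : Triple n → ℕ
  hopIndicator t = count (isHop? C) [ t ]

  innerHops : Segment (Fin n) → ℕ
  innerHops S = count (isHop? C) (triples (path S))

  hop-between : ∀ {x s y} → s ∉ C → x ≢ y → hopIndicator (x , s , y) ≡ 1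
  hop-between {x} {s} {y} s∉C x≢y = count-accept (isHop? C) {x , s , y} (s∉C , x≢y)

  no-hop-loop : ∀ {x s} → hopIndicator (x , s , x) ≡ 0
  no-hop-loop {x} {s} = count-reject (isHop? C) {x , s , x} (λ (_ , x≢x) → x≢x refl)

  no-hop-at-cover : ∀ {x s y} → s ∈ C → ¬ IsHop C (x , s , y)
  no-hop-at-cover s∈C (s∉C , _) = s∉C s∈C

  innerHops-reverseSegment : ∀ {p M q} → innerHops (q , reverse M , p) ≡ innerHops (p , M , q)
  innerHops-reverseSegment {p} {M} {q} = trans (cong (count (isHop? C) ∘ triples) (path-reverseSegment (p , M , q)))
    (count-triples-reverse (isHop? C) (λ (s∉C , x≢y) → s∉C , x≢y ∘ sym) (path (p , M , q)))

  hops-through : ∀ w x {p M q ys} → p ∈ C → q ∈ C →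
                 count (isHop? C) (triples (w ∷ x ∷ through (p , M , q) ys)) ≡
                 hopIndicator (w , x , p) + (innerHops (p , M , q) + count (isHop? C) (triples (q ∷ ys)))
  hops-through w x {p} {M} {q} {ys} p∈C q∈C =
    trans (count-triples-++ (isHop? C) (w ∷ x ∷ []) {p} {M ++ q ∷ ys} (no-hop-at-cover p∈C))
          (cong (hopIndicator (w , x , p) +_)
                (count-triples-++ (isHop? C) (p ∷ M) {q} {ys} (no-hop-at-cover q∈C)))

  numHops-tour : ∀ x {p M q} y {p′ N q′} → p ∈ C → q ∈ C → p′ ∈ C → q′ ∈ C →
                 numHops C (tour x (p , M , q) y (p′ , N , q′)) ≡
                 hopIndicator (q′ , x , p) + innerHops (p , M , q) +
                 (hopIndicator (q , y , p′) + innerHops (p′ , N , q′))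
  numHops-tour x {p} {M} {q} y {p′} {N} {q′} p∈C q∈C p′∈C q′∈C = begin
    numHops C (tour x S y T)
      ≡⟨ cong (count (isHop? C)) occurrences ⟩
    count (isHop? C) (triples (q′ ∷ tour x S y T))
      ≡⟨ hops-through q′ x p∈C q∈C ⟩
    hopIndicator (q′ , x , p) + (innerHops S + count (isHop? C) (triples (q ∷ y ∷ through T (x ∷ []))))
      ≡⟨ cong (λ k → hopIndicator (q′ , x , p) + (innerHops S + k)) (hops-through q y p′∈C q′∈C) ⟩
    hopIndicator (q′ , x , p) + (innerHops S + (hopIndicator (q , y , p′) + (innerHops T + 0)))
      ≡⟨ cong (λ k → hopIndicator (q′ , x , p) + (innerHops S + (hopIndicator (q , y , p′) + k)))
              (+-identityʳ (innerHops T)) ⟩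
    hopIndicator (q′ , x , p) + (innerHops S + (hopIndicator (q , y , p′) + innerHops T))
      ≡⟨ +-assoc (hopIndicator (q′ , x , p)) (innerHops S) _ ⟨
    hopIndicator (q′ , x , p) + innerHops S + (hopIndicator (q , y , p′) + innerHops T) ∎
    where
    open ≡-Reasoning
    S = (p , M , q)
    T = (p′ , N , q′)
    tour≡walk = tour-walk x {p} {M} {q} y {p′} {N} {q′}
    occurrences : occurrenceTriples (tour x S y T) ≡ triples (q′ ∷ tour x S y T)
    occurrences = begin
      occurrenceTriples (tour x S y T)                          ≡⟨ cong occurrenceTriples tour≡walk ⟩
      occurrenceTriples (walk (x , through S (y ∷ p′ ∷ N) , q′)) ≡⟨ occurrenceTriples-walk x (through S (y ∷ p′ ∷ N)) q′ ⟩
      triples (q′ ∷ walk (x , through S (y ∷ p′ ∷ N) , q′))     ≡⟨ cong (triples ∘ (q′ ∷_)) tour≡walk ⟨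
      triples (q′ ∷ tour x S y T)                               ∎
  IsHopBetween : Fin n → Fin n → Triple n → Set
  IsHopBetween u v (x , s , y) = IsHop C (x , s , y) × x ≡ u × y ≡ v

  isHopBetween? : ∀ u v → Decidable (IsHopBetween u v)
  isHopBetween? u v (x , s , y) = isHop? C (x , s , y) ×-dec (x ≟ u ×-dec y ≟ v)

  degHP≤hopsBetween : ∀ P u v → degHP C P (u , v) ≤ count (isHopBetween? u v) (occurrenceTriples P)
  degHP≤hopsBetween P u v =
    sum-count-fibres≤count (isHopBetween? u v) (λ y t → isHop? C t ×-dec triple≟ t (u , y , v))
      (proj₁ ∘ proj₂) (λ { (hop , refl) → (hop , refl , refl) , refl })
      (filter⁺ (λ y → ¬? (y ∈? C)) (allFin⁺ n)) (occurrenceTriples P)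

  numHops-two-hops : ∀ x {u v M} y {N} → u ∈ C → v ∈ C → u ≢ v → x ∉ C → y ∉ C →
                     numHops C (tour x (v , M , u) y (v , N , u)) ≡
                     suc (innerHops (v , M , u)) + suc (innerHops (v , N , u))
  numHops-two-hops x {u} {v} {M} y {N} u∈C v∈C u≢v x∉C y∉C
    rewrite numHops-tour x {v} {M} {u} y {v} {N} {u} v∈C u∈C v∈C u∈C
          | hop-between {u} {x} {v} x∉C u≢v | hop-between {u} {y} {v} y∉C u≢v = refl

  numHops-reverseSegmentˡ : ∀ x {u v M} y {N} → u ∈ C → v ∈ C →
                            numHops C (tour x (reverseSegment (v , M , u)) y (v , N , u)) ≡
                            innerHops (v , M , u) + innerHops (v , N , u)
  numHops-reverseSegmentˡ x {u} {v} {M} y {N} u∈C v∈C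
    rewrite numHops-tour x {u} {reverse M} {v} y {v} {N} {u} u∈C v∈C v∈C u∈C
          | no-hop-loop {u} {x} | no-hop-loop {v} {y} | innerHops-reverseSegment {v} {M} {u} = refl

  numHops-reverseSegmentʳ : ∀ x {u v M} y {N} → u ∈ C → v ∈ C →
                            numHops C (tour x (v , M , u) y (reverseSegment (v , N , u))) ≡
                            innerHops (v , M , u) + innerHops (v , N , u)
  numHops-reverseSegmentʳ x {u} {v} {M} y {N} u∈C v∈C
    rewrite numHops-tour x {v} {M} {u} y {u} {reverse N} {v} v∈C u∈C u∈C v∈C
          | no-hop-loop {v} {x} | no-hop-loop {u} {y} | innerHops-reverseSegment {v} {N} {u} = refl

m+n≡o+o⇒m≤o⊎n≤o : ∀ {m n o} → m + n ≡ o + o → m ≤ o ⊎ n ≤ o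
m+n≡o+o⇒m≤o⊎n≤o {m} {n} {o} eq with m ≤? o | n ≤? o
... | yes m≤o | _       = inj₁ m≤o
... | no _    | yes n≤o = inj₂ n≤o
... | no m≰o  | no n≰o  = ⊥-elim (<-irrefl (sym eq) (+-mono-< (≰⇒> m≰o) (≰⇒> n≰o)))

module _ {n : ℕ} (G : WGraph n) (C : Subset n) where

  IsHopMinimalOptimalTour : List (Fin n) → Set
  IsHopMinimalOptimalTour P = IsOptimalTSPTour G P × (∀ Q → IsOptimalTSPTour G Q → numHops C P ≤ numHops C Q)

  hopMinimal⇒numHops≤ : ∀ {P Q} → IsHopMinimalOptimalTour P → IsTSPTour G Q → weight G Q ≤ weight G P →
                        numHops C P ≤ numHops C Q
  hopMinimal⇒numHops≤ ((_ , P-opt) , P-min) Q-tour Q≤P =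
    P-min _ (Q-tour , λ R R-tour → ≤-trans Q≤P (P-opt R R-tour))

  rotate-hopMinimal : ∀ c {t ts} → occurrenceTriples (walk c) ≡ t ∷ ts →
                      IsHopMinimalOptimalTour (walk c) → IsHopMinimalOptimalTour (walk (rotate c))
  rotate-hopMinimal c {t} {ts} eq ((c-tour , c-opt) , c-min) =
    (rotate-isTSPTour G c c-tour , λ Q Q-tour → ≤-trans (≤-reflexive (weight-rotate G c)) (c-opt Q Q-tour)) ,
    λ Q Q-opt → ≤-trans (≤-reflexive numHops-rotate) (c-min Q Q-opt)
    where
    open ≡-Reasoning
    numHops-rotate : numHops C (walk (rotate c)) ≡ numHops C (walk c)
    numHops-rotate = begin
      count (isHop? C) (occurrenceTriples (walk (rotate c)))
        ≡⟨ cong (count (isHop? C)) (occurrenceTriples-rotate c eq) ⟩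
      count (isHop? C) (ts ∷ʳ t)
        ≡⟨ count-∷ʳ (isHop? C) ts t ⟩
      count (isHop? C) (t ∷ ts)
        ≡⟨ cong (count (isHop? C)) eq ⟨
      count (isHop? C) (occurrenceTriples (walk c)) ∎

  rotate-hopMinimal-to : ∀ ts {us} c → occurrenceTriples (walk c) ≡ ts ++ us →
                         IsHopMinimalOptimalTour (walk c) →
                         ∃ λ c′ → occurrenceTriples (walk c′) ≡ us ++ ts × IsHopMinimalOptimalTour (walk c′)
  rotate-hopMinimal-to []       c eq c-min = c , trans eq (sym (++-identityʳ _)) , c-min
  rotate-hopMinimal-to (t ∷ ts) {us} c eq c-min
    with rotate-hopMinimal-to ts {us ∷ʳ t} (rotate c)
           (trans (occurrenceTriples-rotate c eq) (++-assoc ts us [ t ])) (rotate-hopMinimal c eq c-min)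
  ... | c′ , eq′ , c′-min = c′ , trans eq′ (++-assoc us [ t ] ts) , c′-min

  two-hops-between-not-hopMinimal : ∀ {u v x y M N} → u ∈ C → v ∈ C → u ≢ v → x ∉ C → y ∉ C →
                                    ¬ IsHopMinimalOptimalTour (tour x (v , M , u) y (v , N , u))
  two-hops-between-not-hopMinimal {u} {v} {x} {y} {M} {N} u∈C v∈C u≢v x∉C y∉C D-min@((D-tour , _) , _) =
    [ (λ Q₁≤D → <⇒≱ (fewer (numHops-reverseSegmentˡ C x {u} {v} {M} y {N} u∈C v∈C))
                    (hopMinimal⇒numHops≤ D-min (tour-reverseˡ G x y D-tour) Q₁≤D))
    , (λ Q₂≤D → <⇒≱ (fewer (numHops-reverseSegmentʳ C x {u} {v} {M} y {N} u∈C v∈C))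
                    (hopMinimal⇒numHops≤ D-min (tour-reverseʳ G x y D-tour) Q₂≤D))
    ]′ (m+n≡o+o⇒m≤o⊎n≤o (weight-reverseSegments G x {v} {M} {u} y {N}))
    where
    hS = innerHops C (v , M , u)
    hT = innerHops C (v , N , u)
    fewer : ∀ {h} → h ≡ hS + hT → h < numHops C (tour x (v , M , u) y (v , N , u))
    fewer refl = <-≤-trans (s≤s (+-monoʳ-≤ hS (n≤1+n hT)))
                           (≤-reflexive (sym (numHops-two-hops C x {u} {v} {M} y {N} u∈C v∈C u≢v x∉C y∉C)))

  walk-hopsBetween≤1 : ∀ {u v} → u ∈ C → v ∈ C → u ≢ v → ∀ c → IsHopMinimalOptimalTour (walk c) →
                       count (isHopBetween? C u v) (occurrenceTriples (walk c)) ≤ 1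
  walk-hopsBetween≤1 {u} {v} u∈C v∈C u≢v c c-min = count≤1 (isHopBetween? C u v) _ no-two
    where
    ∉∈⇒≢ : ∀ {x w} → x ∉ C → w ∈ C → x ≢ w
    ∉∈⇒≢ x∉C w∈C refl = x∉C w∈C
    no-two : ∀ {ts t us t′ ws} → occurrenceTriples (walk c) ≡ ts ++ t ∷ us ++ t′ ∷ ws →
             IsHopBetween C u v t → IsHopBetween C u v t′ → ⊥
    no-two {ts} {_ , x , _} {us} {_ , y , _} {ws} eq ((x∉C , _) , refl , refl) ((y∉C , _) , refl , refl)
      with rotate-hopMinimal-to ts c eq c-min
    ... | c′ , eq′ , c′-min
      with walk-with-two-hops c′ u≢v (∉∈⇒≢ x∉C u∈C) (∉∈⇒≢ x∉C v∈C)
             (trans eq′ (cong ((u , x , v) ∷_) (++-assoc us ((u , y , v) ∷ ws) ts)))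
    ...   | M , N , c′≡tour =
      two-hops-between-not-hopMinimal u∈C v∈C u≢v x∉C y∉C
        (subst IsHopMinimalOptimalTour c′≡tour c′-min)

  hopsBetween≤1 : ∀ {u v} → u ∈ C → v ∈ C → u ≢ v → ∀ P → IsHopMinimalOptimalTour P →
                  count (isHopBetween? C u v) (occurrenceTriples P) ≤ 1
  hopsBetween≤1 {u} {v} u∈C v∈C u≢v P P-min@(((P-closed , _) , _) , _) with walk-view G P P-closed
  ... | inj₁ none = subst (λ ts → count (isHopBetween? C u v) ts ≤ 1) (sym none) z≤n
  ... | inj₂ (c , refl) = walk-hopsBetween≤1 u∈C v∈C u≢v c P-min

lemma2 : ∀ {n} (G : WGraph n) (C : Subset n) → IsVertexCover G C →
    (P : List (Fin n)) → IsOptimalTSPTour G P →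
    (∀ Q → IsOptimalTSPTour G Q → numHops C P ≤ numHops C Q) →
    ∀ u v → InX C (u , v) → degHP C P (u , v) ≤ 1
lemma2 G C _ P P-opt P-min u v (u∈C , v∈C , u≢v) =
  ≤-trans (degHP≤hopsBetween C P u v) (hopsBetween≤1 G C u∈C v∈C u≢v P (P-opt , P-min))
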